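{- Let $\mathcal{L}$ be a $T$-language, let $\Gamma$ be a set of $\mathcal{L}$-wffs, and let $\mathfrak{M}=(M,A_1\times A_2,\nu,F)$, where $A_1,A_2$ are truth-value algebras of type $T$ and $A_1\times A_2$ is their product, be a model of $\Gamma$. Then for $i=1,2$, $\mathfrak{M}_i:=(M,A_i,p_i\circ\nu,F)$ is a model of $\Gamma$, where $p_i:A_1\times A_2\to A_i$ is the natural projection onto $A_i$.
   Context: A type $T=(\alpha,\tau)$: either $\alpha=\{0,\ldots,n\}$ or $\alpha=\mathbb{N}$, and $\tau:\alpha\to\mathbb{N}$ with $i\le j\Rightarrow\tau(i)\ge\tau(j)$. A truth-value algebra of type $T$ is $(A,\leq,O,\ell)$ where $A$ is a set, $(A,\le)$ is a poset with top element $1$, $O$ is a finite or countable set of operations, $\ell:O\to\alpha$ a bijection, and each $f\in O$ is a map $A^{\tau(\ell(f))}\to A$. The product $A_1\times A_2$ of truth-value algebras of the same type has the componentwise order and componentwise operations: for $f\in O_1$ and $\tilde f=\ell_2^{ -1}(\ell_1(f))$, $\hat f((a_1,b_1),\ldots,(a_{N},b_{N}))=(f(a_1,\ldots,a_N),\tilde f(b_1,\ldots,b_N))$, labeled by $\ell_1(f)$. A $T$-language $\mathcal{L}$ consists of disjoint sets $\mathcal{L_P}$ (predicate symbols), $\mathcal{L_F}$ (function symbols) and $\mathcal{L_C}$ (propositional connectives), each symbol having an arity, with $\mathcal{L_C}=\{c_i:i\in\alpha\}$ in bijection with $\alpha$ and $c_i$ of arity $\tau(i)$. Terms are built from variables and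 function symbols (arity-$0$ function symbols are constants); $\mathcal{L}$-wffs are built from atomic formulas $P(t_1,\ldots,t_n)$ using the connectives $c_i$ and the universal quantifier $\forall$; an $\mathcal{L}$-sentence is a wff without free variables. For a set $M$ disjoint from $\mathcal{L}$, $\mathcal{L}^M$ is the $T$-language $\mathcal{L}\cup M$ with elements of $M$ as new constants. An interpretation of $\mathcal{L}$ in $M$ assigns to each $n$-ary $f\in\mathcal{L_F}$ a map $M^n\to M$; it is extended to $\mathcal{L}^M$ by $F(a)=a$ for $a\in M$, and $F(t)\in M$ denotes the value of a variable-free $\mathcal{L}^M$-term $t$. A truth valuation for $F$ in $A$ (with labeling $\ell$) is a surjective map $\nu$ from the set of $\mathcal{L}^M$-sentences to $A$ such that: (1) $\nu(P(t_1,\ldots,t_n))=\nu(P(F(t_1),\ldots,F(t_n)))$ for $n$-ary $P\in\mathcal{L_P}$ and variable-free terms $t_j$; (2) $\nu(c_i(\psi_1,\ldots,\psi_n))=f_i(\nu(\psi_1),\ldots,\nu(\psi_n))$ where $f_i=\ell^{ -1}(i)$; (3) whenever $\bigwedge_{a\in M}\nu(\psi(a))$ exists for an $\mathcal{L}^M$-wff $\psi(x)$, $\nu((\forall x)\psi(x))=\bigwedge_{a\in M}\nu(\psi(a))$; (4) $\bigwedge_{a\in M}\nu(\psi(a))$ exists in $(A,\le)$ for every $\mathcal{L}^M$-wff $\psi(x)$. $\nu$ is extended to all $\mathcal{L}^M$-wffs by $\nu(\psi(x_1,\ldots,x_n)):=\nu((\forall x_1)\cdots(\forall x_n)\psi)$.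 An $\mathcal{L}$-structure is a tuple $(M,A,\nu,F)$ with $M$ a set, $A$ a truth-value algebra of type $T$, $F$ an interpretation of $\mathcal{L}$ in $M$, and $\nu$ a truth valuation for $F$ in $A$. It is a model of a set $\Gamma$ of $\mathcal{L}$-wffs if $\nu(\gamma(a_1,\ldots,a_n))=1$ for every $\gamma(x_1,\ldots,x_n)\in\Gamma$ and all $a_1,\ldots,a_n\in M$. -}

module Defs where

open import Data.Nat using (ℕ; suc; _≟_)
import Data.Nat as Nat
open import Data.Fin using (Fin; toℕ)
open import Data.Maybe using (Maybe; just; nothing)
open import Data.Vec using (Vec; []; _∷_)
import Data.Vec as Vec
open import Data.List using (List; []; _∷_; _++_; filterᵇ; null)
open import Data.Bool using (Bool; not; if_then_else_) renaming (T to True)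
open import Data.Product using (Σ; ∃; _×_; _,_; proj₁; proj₂)
open import Data.Empty using (⊥; ⊥-elim)
open import Relation.Binary.PropositionalEquality using (_≡_; refl; sym; cong₂; subst; isEquivalence)
open import Relation.Binary.Structures using (IsPartialOrder; IsPreorder)
open import Relation.Nullary.Decidable using (⌊_⌋)
open import Function.Bundles using (_↔_; Inverse)

Idx : Maybe ℕ → Set
Idx nothing  = ℕ
Idx (just n) = Fin (suc n)

idxℕ : ∀ {m} → Idx m → ℕ
idxℕ {nothing} i = i
idxℕ {just n}  i = toℕ i

record TypeT : Set where
  field
    bound      : Maybe ℕ
    τ          : Idx bound → ℕ
    τ-antitone : ∀ i j → idxℕ i Nat.≤ idxℕ j → τ j Nat.≤ τ i
  α : Set
  α = Idx bound

-- Truth-value algebras of type T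
-- (O is finite or countable automatically, being in bijection with α)

record TVA (T : TypeT) : Set₁ where
  open TypeT T
  field
    Carrier        : Set
    _≤_            : Carrier → Carrier → Set
    isPartialOrder : IsPartialOrder _≡_ _≤_
    top            : Carrier
    ≤-top          : ∀ a → a ≤ top
    O              : Set
    ℓ              : O ↔ α
    op             : (f : O) → Vec Carrier (τ (Inverse.to ℓ f)) → Carrier

open TVA public using (Carrier; top; O; op)

private
  ×-isPartialOrder : ∀ {A B : Set} {_≤₁_ : A → A → Set} {_≤₂_ : B → B → Set} →
    IsPartialOrder _≡_ _≤₁_ → IsPartialOrder _≡_ _≤₂_ →
    IsPartialOrder _≡_ (λ (x y : A × B) → (proj₁ x ≤₁ proj₁ y) × (proj₂ x ≤₂ proj₂ y))
  ×-isPartialOrder p q = record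
    { isPreorder = record
      { isEquivalence = isEquivalence
      ; reflexive = λ { refl → IsPartialOrder.refl p , IsPartialOrder.refl q }
      ; trans = λ { (a , b) (c , d) → IsPartialOrder.trans p a c , IsPartialOrder.trans q b d }
      }
    ; antisym = λ { (a , b) (c , d) → cong₂ _,_ (IsPartialOrder.antisym p a c) (IsPartialOrder.antisym q b d) }
    }

-- product of truth-value algebras of the same type; operations labelled by ℓ₁
_⊗_ : ∀ {T} → TVA T → TVA T → TVA T
_⊗_ {T} A₁ A₂ = record
  { Carrier = Carrier A₁ × Carrier A₂
  ; _≤_ = λ x y → (TVA._≤_ A₁ (proj₁ x) (proj₁ y)) × (TVA._≤_ A₂ (proj₂ x) (proj₂ y))
  ; isPartialOrder = ×-isPartialOrder (TVA.isPartialOrder A₁) (TVA.isPartialOrder A₂)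
  ; top = top A₁ , top A₂
  ; ≤-top = λ a → TVA.≤-top A₁ (proj₁ a) , TVA.≤-top A₂ (proj₂ a)
  ; O = O A₁
  ; ℓ = TVA.ℓ A₁
  ; op = λ f xs →
      op A₁ f (Vec.map proj₁ xs) ,
      op A₂ (Inverse.from (TVA.ℓ A₂) (Inverse.to (TVA.ℓ A₁) f))
        (subst (λ k → Vec (Carrier A₂) (TypeT.τ T k))
               (sym (Inverse.strictlyInverseˡ (TVA.ℓ A₂) (Inverse.to (TVA.ℓ A₁) f)))
               (Vec.map proj₂ xs))
  }

-- T-languages: predicate symbols, function symbols (arity 0 = constants);
-- the connectives are c_i, i ∈ α, with arity τ(i).

record Language (T : TypeT) : Set₁ where
  field
    PredSym : Set
    FunSym  : Set
    parity  : PredSym → ℕ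
    farity  : FunSym → ℕ

open Language public using (PredSym; FunSym; parity; farity)

-- Terms / wffs of L ∪ C, where C is a set of extra constants
-- (C = ⊥ gives L-terms / L-wffs, C = M gives L^M-terms / L^M-wffs).
-- Variables are named by natural numbers.
data Term {T : TypeT} (L : Language T) (C : Set) : Set where
  var : ℕ → Term L C
  con : C → Term L C
  fun : (f : FunSym L) → Vec (Term L C) (farity L f) → Term L C

data Formula {T : TypeT} (L : Language T) (C : Set) : Set where
  atom : (P : PredSym L) → Vec (Term L C) (parity L P) → Formula L C
  conn : (i : TypeT.α T) → Vec (Formula L C) (TypeT.τ T i) → Formula L C
  all  : ℕ → Formula L C → Formula L C

data GTerm {T : TypeT} (L : Language T) (C : Set) : Set where
  gcon : C → GTerm L C
  gfun : (f : FunSym L) → Vec (GTerm L C) (farity L f) → GTerm L C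

module _ {T : TypeT} {L : Language T} where

  mutual
    gembed : ∀ {C} → GTerm L C → Term L C
    gembed (gcon c) = con c
    gembed (gfun f ts) = fun f (gembeds ts)

    gembeds : ∀ {C n} → Vec (GTerm L C) n → Vec (Term L C) n
    gembeds [] = []
    gembeds (t ∷ ts) = gembed t ∷ gembeds ts

  mutual
    fvT : ∀ {C} → Term L C → List ℕ
    fvT (var x) = x ∷ []
    fvT (con c) = []
    fvT (fun f ts) = fvTs ts

    fvTs : ∀ {C n} → Vec (Term L C) n → List ℕ
    fvTs [] = []
    fvTs (t ∷ ts) = fvT t ++ fvTs ts

  mutual
    fv : ∀ {C} → Formula L C → List ℕ
    fv (atom P ts) = fvTs ts
    fv (conn i ψs) = fvs ψs
    fv (all x ψ) = filterᵇ (λ y → not ⌊ y ≟ x ⌋) (fv ψ)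

    fvs : ∀ {C n} → Vec (Formula L C) n → List ℕ
    fvs [] = []
    fvs (ψ ∷ ψs) = fv ψ ++ fvs ψs

  closed : ∀ {C} → Formula L C → Bool
  closed ψ = null (fv ψ)

  mutual
    substT : ∀ {C} → ℕ → C → Term L C → Term L C
    substT x a (var y) = if ⌊ y ≟ x ⌋ then con a else var y
    substT x a (con c) = con c
    substT x a (fun f ts) = fun f (substTs x a ts)

    substTs : ∀ {C n} → ℕ → C → Vec (Term L C) n → Vec (Term L C) n
    substTs x a [] = []
    substTs x a (t ∷ ts) = substT x a t ∷ substTs x a ts

  mutual
    subst1 : ∀ {C} → ℕ → C → Formula L C → Formula L C
    subst1 x a (atom P ts) = atom P (substTs x a ts)
    subst1 x a (conn i ψs) = conn i (substs x a ψs)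
    subst1 x a (all y ψ) = if ⌊ y ≟ x ⌋ then all y ψ else all y (subst1 x a ψ)

    substs : ∀ {C n} → ℕ → C → Vec (Formula L C) n → Vec (Formula L C) n
    substs x a [] = []
    substs x a (ψ ∷ ψs) = subst1 x a ψ ∷ substs x a ψs

  substAll : ∀ {C n} → Vec ℕ n → Vec C n → Formula L C → Formula L C
  substAll [] [] ψ = ψ
  substAll (x ∷ xs) (a ∷ as) ψ = substAll xs as (subst1 x a ψ)

  mutual
    mapT : ∀ {C D} → (C → D) → Term L C → Term L D
    mapT g (var x) = var x
    mapT g (con c) = con (g c)
    mapT g (fun f ts) = fun f (mapTs g ts)

    mapTs : ∀ {C D n} → (C → D) → Vec (Term L C) n → Vec (Term L D) n
    mapTs g [] = []
    mapTs g (t ∷ ts) = mapT g t ∷ mapTs g ts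

  mutual
    mapF : ∀ {C D} → (C → D) → Formula L C → Formula L D
    mapF g (atom P ts) = atom P (mapTs g ts)
    mapF g (conn i ψs) = conn i (mapFs g ψs)
    mapF g (all x ψ) = all x (mapF g ψ)

    mapFs : ∀ {C D n} → (C → D) → Vec (Formula L C) n → Vec (Formula L D) n
    mapFs g [] = []
    mapFs g (ψ ∷ ψs) = mapF g ψ ∷ mapFs g ψs

  fromL : ∀ {M : Set} → Formula L ⊥ → Formula L M
  fromL = mapF ⊥-elim

-- sentences of L ∪ C (closedness is a Bool, so proofs are unique)
Sentence : ∀ {T} (L : Language T) (C : Set) → Set
Sentence L C = Σ (Formula L C) (λ ψ → True (closed ψ))

record Interp {T : TypeT} (L : Language T) (M : Set) : Set where
  field
    ifun : (f : FunSym L) → Vec M (farity L f) → M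

module _ {T : TypeT} {L : Language T} {M : Set} (F : Interp L M) where
  mutual
    eval : GTerm L M → M
    eval (gcon a) = a
    eval (gfun f ts) = Interp.ifun F f (evals ts)

    evals : ∀ {n} → Vec (GTerm L M) n → Vec M n
    evals [] = []
    evals (t ∷ ts) = eval t ∷ evals ts

IsGLB : ∀ {T} (A : TVA T) {I : Set} → (I → Carrier A) → Carrier A → Set
IsGLB A h g = (∀ i → TVA._≤_ A g (h i)) × (∀ z → (∀ i → TVA._≤_ A z (h i)) → TVA._≤_ A z g)

record IsTruthValuation {T : TypeT} (L : Language T) (M : Set) (F : Interp L M)
         (A : TVA T) (ν : Sentence L M → Carrier A) : Set where
  field
    surjective : ∀ a → ∃ λ s → ν s ≡ a
    atomic : ∀ (P : PredSym L) (ts : Vec (GTerm L M) (parity L P)) pf pf' →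
      ν (atom P (Vec.map gembed ts) , pf) ≡ ν (atom P (Vec.map (λ t → con (eval F t)) ts) , pf')
    -- (2)  f_i = ℓ⁻¹(i), whose arity τ(ℓ(ℓ⁻¹ i)) is identified with τ(i)
    connective : ∀ (i : TypeT.α T) (ψs : Vec (Sentence L M) (TypeT.τ T i)) pf →
      ν (conn i (Vec.map proj₁ ψs) , pf) ≡
        op A (Inverse.from (TVA.ℓ A) i)
          (subst (λ k → Vec (Carrier A) (TypeT.τ T k))
                 (sym (Inverse.strictlyInverseˡ (TVA.ℓ A) i))
                 (Vec.map ν ψs))
    -- (3)  for wffs ψ(x) (only x free, i.e. (∀x)ψ a sentence)
    forall-meet : ∀ (x : ℕ) (ψ : Formula L M) (pf : True (closed (all x ψ)))
      (h : ∀ a → True (closed (subst1 x a ψ))) (g : Carrier A) →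
      IsGLB A (λ a → ν (subst1 x a ψ , h a)) g → ν (all x ψ , pf) ≡ g
    meet-exists : ∀ (x : ℕ) (ψ : Formula L M) (pf : True (closed (all x ψ)))
      (h : ∀ a → True (closed (subst1 x a ψ))) →
      ∃ λ g → IsGLB A (λ a → ν (subst1 x a ψ , h a)) g

Satisfies : ∀ {T} (L : Language T) (Γ : Formula L ⊥ → Set) (M : Set) (A : TVA T)
  (ν : Sentence L M → Carrier A) → Set
Satisfies L Γ M A ν = ∀ γ → Γ γ → ∀ n (xs : Vec ℕ n) (as : Vec M n)
  (pf : True (closed (substAll xs as (fromL γ)))) → ν (substAll xs as (fromL γ) , pf) ≡ top A

IsModel : ∀ {T} (L : Language T) (Γ : Formula L ⊥ → Set) (M : Set) (A : TVA T)
  (F : Interp L M) (ν : Sentence L M → Carrier A) → Set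
IsModel L Γ M A F ν = IsTruthValuation L M F A ν × Satisfies L Γ M A ν

-- A truth valuation is pushed forward along any surjective map of truth-value
-- algebras that preserves the top element, the operations and all existing
-- meets: the clauses for atoms, connectives and Γ transfer by applying the map,
-- and the quantifier clause because the image of the meet of a family is the
-- meet of the image family, and meets are unique. Both projections out of
-- A₁ × A₂ are such maps, since order, meets and operations of the product are
-- componentwise and each factor is inhabited (by its top element).
module Submission where

open import Defs
open import Data.Product using (_×_; _,_; proj₁; proj₂; ∃)
open import Data.Empty using (⊥)
open import Data.Vec using (Vec)
import Data.Vec as Vec
open import Data.Vec.Properties using (map-∘)
open import Function using (_∘_)
open import Function.Bundles using (Inverse)
open import Relation.Binary.PropositionalEquality
open import Relation.Binary.PropositionalEquality.Properties using (subst-application′)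
open import Relation.Binary.Structures using (IsPartialOrder)

module _ {T : TypeT} where
  open TypeT T using (α; τ)

  -- The paper's f_i = ℓ⁻¹(i), with its arity τ(ℓ(ℓ⁻¹ i)) identified with τ(i)
  -- exactly as in the connective clause of a truth valuation.
  operation : (A : TVA T) (i : α) → Vec (Carrier A) (τ i) → Carrier A
  operation A i v = op A (Inverse.from ℓ i)
    (subst (Vec (Carrier A) ∘ τ) (sym (Inverse.strictlyInverseˡ ℓ i)) v)
    where open TVA A using (ℓ)

  operation-subst : (A : TVA T) {i j : α} (i≡j : i ≡ j) (v : Vec (Carrier A) (τ i)) →
    operation A j (subst (Vec (Carrier A) ∘ τ) i≡j v) ≡ operation A i v
  operation-subst A refl v = refl

  map-subst : {X Y : Set} (h : X → Y) {i j : α} (i≡j : i ≡ j) (v : Vec X (τ i)) →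
    Vec.map h (subst (Vec X ∘ τ) i≡j v) ≡ subst (Vec Y ∘ τ) i≡j (Vec.map h v)
  map-subst {X} h i≡j v = sym (subst-application′ (Vec X ∘ τ) (λ _ → Vec.map h) i≡j)

  IsGLB-unique : (A : TVA T) {I : Set} {h : I → Carrier A} {g g′ : Carrier A} →
    IsGLB A h g → IsGLB A h g′ → g ≡ g′
  IsGLB-unique A (g≤h , g-greatest) (g′≤h , g′-greatest) =
    IsPartialOrder.antisym (TVA.isPartialOrder A) (g′-greatest _ g≤h) (g-greatest _ g′≤h)

  record IsSurjectiveHomomorphism (A B : TVA T) (π : Carrier A → Carrier B) : Set₁ where
    field
      surjective : ∀ b → ∃ λ a → π a ≡ b
      top-preserving : π (top A) ≡ top B
      operation-preserving : ∀ i (v : Vec (Carrier A) (τ i)) →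
        π (operation A i v) ≡ operation B i (Vec.map π v)
      glb-preserving : ∀ {I : Set} {h : I → Carrier A} {g : Carrier A} →
        IsGLB A h g → IsGLB B (π ∘ h) (π g)

  module Pushforward {L : Language T} {M : Set} {F : Interp L M} {A B : TVA T}
      {π : Carrier A → Carrier B} (hom : IsSurjectiveHomomorphism A B π)
      {ν : Sentence L M → Carrier A} where
    open IsSurjectiveHomomorphism hom

    isTruthValuation : IsTruthValuation L M F A ν → IsTruthValuation L M F B (π ∘ ν)
    isTruthValuation tv = record
      { surjective = λ b →
          let (a , πa≡b) = surjective b
              (s , νs≡a) = ν-surjective a
          in s , trans (cong π νs≡a) πa≡b
      ; atomic = λ P ts pf pf′ → cong π (atomic P ts pf pf′)
      ; connective = λ i ψs pf → begin
          π (ν (conn i (Vec.map proj₁ ψs) , pf))   ≡⟨ cong π (connective i ψs pf) ⟩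
          π (operation A i (Vec.map ν ψs))         ≡⟨ operation-preserving i (Vec.map ν ψs) ⟩
          operation B i (Vec.map π (Vec.map ν ψs)) ≡⟨ cong (operation B i) (sym (map-∘ π ν ψs)) ⟩
          operation B i (Vec.map (π ∘ ν) ψs)       ∎
      ; forall-meet = λ x ψ pf h g g-glb →
          let (G , G-glb) = meet-exists x ψ pf h
          in trans (cong π (forall-meet x ψ pf h G G-glb))
                   (IsGLB-unique B (glb-preserving G-glb) g-glb)
      ; meet-exists = λ x ψ pf h →
          let (G , G-glb) = meet-exists x ψ pf h in π G , glb-preserving G-glb
      }
      where
        open IsTruthValuation tv hiding (surjective)
        open IsTruthValuation tv using () renaming (surjective to ν-surjective)
        open ≡-Reasoning

    satisfies : ∀ {Γ} → Satisfies L Γ M A ν → Satisfies L Γ M B (π ∘ ν)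
    satisfies sat γ γ∈Γ n xs as pf = trans (cong π (sat γ γ∈Γ n xs as pf)) top-preserving

    isModel : ∀ {Γ} → IsModel L Γ M A F ν → IsModel L Γ M B F (π ∘ ν)
    isModel (tv , sat) = isTruthValuation tv , satisfies sat

  module _ (A₁ A₂ : TVA T) where

    proj₁-isSurjectiveHomomorphism : IsSurjectiveHomomorphism (A₁ ⊗ A₂) A₁ proj₁
    proj₁-isSurjectiveHomomorphism = record
      { surjective = λ a → (a , top A₂) , refl
      ; top-preserving = refl
      ; operation-preserving = λ i v →
          cong (op A₁ (Inverse.from (TVA.ℓ A₁) i))
               (map-subst proj₁ (sym (Inverse.strictlyInverseˡ (TVA.ℓ A₁) i)) v)
      ; glb-preserving = λ { {g = _ , g₂} (g≤h , g-greatest) →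
            (λ i → proj₁ (g≤h i))
          , (λ z z≤h → proj₁ (g-greatest (z , g₂) (λ i → z≤h i , proj₂ (g≤h i)))) }
      }

    -- The product labels its operations by ℓ₁, so the second component of
    -- f_i is computed at the index ℓ₁(ℓ₁⁻¹ i), which is only propositionally i.
    proj₂-isSurjectiveHomomorphism : IsSurjectiveHomomorphism (A₁ ⊗ A₂) A₂ proj₂
    proj₂-isSurjectiveHomomorphism = record
      { surjective = λ b → (top A₁ , b) , refl
      ; top-preserving = refl
      ; operation-preserving = λ i v →
          let i≡ℓ₁ℓ₁⁻¹i = sym (Inverse.strictlyInverseˡ (TVA.ℓ A₁) i)
          in trans (cong (operation A₂ _) (map-subst proj₂ i≡ℓ₁ℓ₁⁻¹i v))
                   (operation-subst A₂ i≡ℓ₁ℓ₁⁻¹i (Vec.map proj₂ v))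
      ; glb-preserving = λ { {g = g₁ , _} (g≤h , g-greatest) →
            (λ i → proj₂ (g≤h i))
          , (λ z z≤h → proj₂ (g-greatest (g₁ , z) (λ i → proj₁ (g≤h i) , z≤h i))) }
      }

proposition2p2 : ∀ {T : TypeT} (L : Language T) (Γ : Formula L ⊥ → Set) (M : Set)
    (A₁ A₂ : TVA T) (F : Interp L M) (ν : Sentence L M → Carrier (A₁ ⊗ A₂)) →
    IsModel L Γ M (A₁ ⊗ A₂) F ν →
    IsModel L Γ M A₁ F (proj₁ ∘ ν) × IsModel L Γ M A₂ F (proj₂ ∘ ν)
proposition2p2 L Γ M A₁ A₂ F ν model =
    Pushforward.isModel (proj₁-isSurjectiveHomomorphism A₁ A₂) model
  , Pushforward.isModel (proj₂-isSurjectiveHomomorphism A₁ A₂) model
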